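{- The Multiobjective Spanner (MSp) problem is intractable even when restricted to instances whose graph is degree-3 bounded and outerplanar. That is, there is no algorithm that, for every such instance $I$, outputs the non-dominated set $\mathcal{Y}_N$ of $I$ in time bounded by a polynomial in the size of $I$.
   Context: MSp: the input is a connected, undirected graph $G=(V,E)$ with edge-weight functions $c_1\colon E\to\mathbb{Z}$ and $c_2\colon E\to\mathbb{N}_+$. A feasible solution (spanner) is a set $S\subseteq E$ such that $(V,S)$ is connected. Each spanner $S$ has value vector $f(S)=(f_1(S),f_2(S))^\mathsf{T}$ with $f_1(S)=\sum_{e\in S}c_1(e)$ and $f_2(S)=\max_{u,v\in V,\,u\neq v}\frac{d^S_{c_2}(u,v)}{d^E_{c_2}(u,v)}$, where $d^F_{c_2}(u,v)$ is the length of a shortest $u$-$v$-path using only edges of $F$ with respect to lengths $c_2$. For value vectors $y\neq y'$, $y$ is dominated by $y'$ if $y'\le y$ componentwise. The non-dominated set $\mathcal{Y}_N$ is the set of value vectors of spanners that are not dominated by the value vector of any spanner; solving an instance means outputting $\mathcal{Y}_N$. A graph is degree-3 bounded if every vertex has degree at most 3, and outerplanar if it has a drawing with all vertices on the boundary of the outer face. -}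

module Defs where

open import Data.Nat using (ℕ; zero; suc; _+_; _*_; _^_; _<_; _≤_)
open import Data.Nat.Logarithm using (⌈log₂_⌉)
open import Data.Integer as ℤ using (ℤ; +_; ∣_∣)
open import Data.Rational as ℚ using (ℚ)
open import Data.Fin as Fin using (Fin; toℕ)
open import Data.Bool using (Bool; true; false; if_then_else_; _∨_)
open import Data.Product using (Σ; _×_; _,_; proj₁; proj₂; ∃; ∃-syntax)
open import Data.Sum using (_⊎_)
open import Data.List using (List; length)
open import Data.List.Relation.Unary.All using (All)
open import Data.List.Relation.Unary.Unique.Propositional using (Unique)
open import Relation.Nullary using (¬_; ⌊_⌋)
open import Relation.Binary.PropositionalEquality using (_≡_; _≢_)
open import Function.Definitions using (Injective)

sumℕ : (m : ℕ) → (Fin m → ℕ) → ℕ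
sumℕ zero    f = 0
sumℕ (suc m) f = f Fin.zero + sumℕ m (λ i → f (Fin.suc i))

sumℤ : (m : ℕ) → (Fin m → ℤ) → ℤ
sumℤ zero    f = + 0
sumℤ (suc m) f = f Fin.zero ℤ.+ sumℤ m (λ i → f (Fin.suc i))

-- An MSp instance: vertices Fin n, edges Fin m with endpoints ends e
-- (an undirected edge {u,v} is stored as an ordered pair, orientation irrelevant),
-- weights c1 : E → ℤ and c2 : E → ℕ₊.
record Instance : Set where
  field
    n      : ℕ
    m      : ℕ
    ends   : Fin m → Fin n × Fin n
    c1     : Fin m → ℤ
    c2     : Fin m → ℕ
    c2-pos : ∀ e → 1 ≤ c2 e

EdgeSet : ℕ → Set
EdgeSet m = Fin m → Bool

module _ (I : Instance) where
  open Instance I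

  Link : Fin m → Fin n → Fin n → Set
  Link e u w = (ends e ≡ (u , w)) ⊎ (ends e ≡ (w , u))

  data Walk (S : EdgeSet m) : Fin n → Fin n → ℕ → Set where
    nil  : ∀ {u} → Walk S u u 0
    cons : ∀ {u w v ℓ} (e : Fin m) → S e ≡ true → Link e u w →
           Walk S w v ℓ → Walk S u v (c2 e + ℓ)

  allEdges : EdgeSet m
  allEdges _ = true

  Connected : EdgeSet m → Set
  Connected S = ∀ u v → ∃[ ℓ ] Walk S u v ℓ

  IsDist : EdgeSet m → Fin n → Fin n → ℕ → Set
  IsDist S u v d = Walk S u v d × (∀ ℓ → Walk S u v ℓ → d ≤ ℓ)

  Simple : Set
  Simple = (∀ e → proj₁ (ends e) ≢ proj₂ (ends e))
         × (∀ e e' → e ≢ e' → ∀ u w → Link e u w → ¬ Link e' u w)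

  Spanner : EdgeSet m → Set
  Spanner S = Connected S

  f₁ : EdgeSet m → ℤ
  f₁ S = sumℤ m (λ e → if S e then c1 e else + 0)

  -- q = d^S(u,v) / d^E(u,v)   (d^E(u,v) = suc k ≥ 1 for u ≠ v)
  IsRatio : EdgeSet m → Fin n → Fin n → ℚ → Set
  IsRatio S u v q = Σ ℕ λ dS → Σ ℕ λ k →
    IsDist S u v dS × IsDist allEdges u v (suc k) × (q ≡ (+ dS) ℚ./ suc k)

  IsF₂ : EdgeSet m → ℚ → Set
  IsF₂ S q = (Σ (Fin n) λ u → Σ (Fin n) λ v → u ≢ v × IsRatio S u v q)
           × (∀ u v q' → u ≢ v → IsRatio S u v q' → q' ℚ.≤ q)

  ValueVec : Set
  ValueVec = ℤ × ℚ

  HasValue : EdgeSet m → ValueVec → Set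
  HasValue S (a , q) = f₁ S ≡ a × IsF₂ S q

  Attained : ValueVec → Set
  Attained y = Σ (EdgeSet m) λ S → Spanner S × HasValue S y

  _DominatedBy_ : ValueVec → ValueVec → Set
  y DominatedBy y' = y ≢ y' × (proj₁ y' ℤ.≤ proj₁ y) × (proj₂ y' ℚ.≤ proj₂ y)

  NonDominated : ValueVec → Set
  NonDominated y = Attained y × (∀ y' → Attained y' → ¬ (y DominatedBy y'))

  degree : Fin n → ℕ
  degree v = sumℕ m (λ e →
    if ⌊ proj₁ (ends e) Fin.≟ v ⌋ ∨ ⌊ proj₂ (ends e) Fin.≟ v ⌋ then 1 else 0)

  Degree3Bounded : Set
  Degree3Bounded = ∀ v → degree v ≤ 3

  Crosses : ℕ → ℕ → ℕ → ℕ → Set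
  Crosses a b c d = (Between c × Outside d) ⊎ (Between d × Outside c)
    where
      lo = Data.Nat._⊓_ a b
      hi = Data.Nat._⊔_ a b
      Between : ℕ → Set
      Between x = lo < x × x < hi
      Outside : ℕ → Set
      Outside x = x < lo ⊎ hi < x

  -- outerplanar: vertices can be placed on a circle (cyclic order pos)
  -- so that no two edges, drawn as chords, cross
  Outerplanar : Set
  Outerplanar = Σ (Fin n → Fin n) λ pos → Injective _≡_ _≡_ pos ×
    (∀ e e' → ¬ Crosses (toℕ (pos (proj₁ (ends e)))) (toℕ (pos (proj₂ (ends e))))
                        (toℕ (pos (proj₁ (ends e')))) (toℕ (pos (proj₂ (ends e')))))

  bits : ℕ → ℕ
  bits k = suc ⌈log₂ suc k ⌉

  size : ℕ
  size = n + m + sumℕ m (λ e → bits ∣ c1 e ∣ + bits (c2 e))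

ValidDeg3Outerplanar : Instance → Set
ValidDeg3Outerplanar I = Simple I × Connected I (allEdges I)
                       × Degree3Bounded I × Outerplanar I

-- The instance is a chain of K gadgets closed by a long edge of length 1 and cost 2^K joining its
-- first and last vertex.  Gadget j offers a direct edge of length L = 2^K and cost 2^j, or a free
-- detour that is 2^j longer.  For t < 2^K let S_t drop the long edge and use direct edge j iff bit j
-- of t is set: S_t costs t, and its stretch is attained on the long edge and equals the length D_t
-- of the chain path in S_t, with t + D_t constant.  Along every edge of a spanner without the long
-- edge, the potential "distance along the chain" grows by at most the edge length, so a spanner
-- weakly dominating (t, D_t) has cost c′ and distance d′ with c′ ≤ t, d′ ≤ D_t and c′ + d′ ≥ t + D_t;
-- hence all 2^K points (t, D_t) are non-dominated, while the instance has size O(K²).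
module Submission where

open import Defs
open import Data.Bool using (Bool; true; false; if_then_else_; _∨_)
open import Data.Bool.Properties using (if-eta; if-float)
open import Data.Empty using (⊥-elim)
open import Data.Fin as Fin using (Fin; zero; suc; toℕ)
open import Data.Fin.Induction using (<-weakInduction)
import Data.Fin.Properties as FinP
import Data.Integer as ℤ
import Data.Integer.Properties as ℤP
open import Data.List using (List; length; applyUpTo)
import Data.List.Properties as ListP
open import Data.List.Relation.Unary.All using (All)
import Data.List.Relation.Unary.All.Properties as AllP
open import Data.List.Relation.Unary.Unique.Propositional using (Unique)
import Data.List.Relation.Unary.Unique.Propositional.Properties as UniqueP
open import Data.Nat using (ℕ; zero; suc; _+_; _*_; _^_; _∸_; _≤_; _<_; z≤n; s≤s; s≤s⁻¹; _≤?_; ⌊_/2⌋; _%_)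
open import Data.Nat.DivMod using ([m+kn]%n≡m%n)
open import Data.Nat.Induction using (<-rec)
open import Data.Nat.Logarithm using (⌈log₂_⌉; ⌈log₂⌉-mono-≤; ⌈log₂2^n⌉≡n)
open import Data.Nat.Properties
open import Data.Nat.Tactic.RingSolver using (solve-∀)
open import Data.Product using (Σ; ∃; ∃₂; _×_; _,_; proj₁; proj₂)
import Data.Product.Properties as ProdP
open import Data.Rational as ℚ using (ℚ)
import Data.Rational.Properties as ℚP
open import Data.Rational.Unnormalised as ℚᵘ using (mkℚᵘ)
import Data.Rational.Unnormalised.Properties as ℚᵘP
open import Data.Sum using (_⊎_; inj₁; inj₂)
open import Function using (_∘_)
open import Relation.Binary.PropositionalEquality
open import Relation.Nullary using (¬_; Dec; yes; no)
open import Relation.Nullary.Decidable using (_⊎-dec_; _×-dec_; map′; ⌊_⌋; ⌊⌋-map′; isYes≗does; dec-false)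
open import Relation.Unary using (Decidable)

Least : (ℕ → Set) → ℕ → Set
Least P d = P d × (∀ j → P j → d ≤ j)

least : ∀ {P : ℕ → Set} → Decidable P → ∀ {n} → P n → ∃ (Least P)
least {P} P? = <-rec (λ n → P n → ∃ (Least P)) search _
  where
  search : ∀ n → (∀ {m} → m < n → P m → ∃ (Least P)) → P n → ∃ (Least P)
  search n below pn with FinP.any? {n = n} (λ i → P? (toℕ i))
  ... | yes (i , pi) = below (FinP.toℕ<n i) pi
  ... | no none = n , pn , λ j pj → ≮⇒≥ λ j<n →
          none (Fin.fromℕ< j<n , subst P (sym (FinP.toℕ-fromℕ< j<n)) pj)

+-tight : ∀ {a b c d} → a ≤ c → b ≤ d → a + b ≡ c + d → a ≡ c × b ≡ d
+-tight {a} {b} {c} {d} a≤c b≤d eq = a≡c , +-cancelˡ-≡ c b d (trans (cong (_+ b) (sym a≡c)) eq)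
  where
  a≡c : a ≡ c
  a≡c = ≤-antisym a≤c (+-cancelʳ-≤ d c a (subst (_≤ a + d) eq (+-monoʳ-≤ a b≤d)))

sumℕ-cong : ∀ m {f g : Fin m → ℕ} → (∀ i → f i ≡ g i) → sumℕ m f ≡ sumℕ m g
sumℕ-cong zero    f≡g = refl
sumℕ-cong (suc m) f≡g = cong₂ _+_ (f≡g zero) (sumℕ-cong m (f≡g ∘ suc))

sumℕ-zero : ∀ m → sumℕ m (λ _ → 0) ≡ 0
sumℕ-zero zero    = refl
sumℕ-zero (suc m) = sumℕ-zero m

sumℕ-≤ : ∀ m {f : Fin m → ℕ} {b} → (∀ i → f i ≤ b) → sumℕ m f ≤ m * b
sumℕ-≤ zero    f≤b = z≤n
sumℕ-≤ (suc m) f≤b = +-mono-≤ (f≤b zero) (sumℕ-≤ m (λ i → f≤b (suc i)))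

sumℤ-if : ∀ m (b : Fin m → Bool) (c : Fin m → ℕ) →
  sumℤ m (λ i → if b i then ℤ.+ c i else ℤ.+ 0) ≡ ℤ.+ sumℕ m (λ i → if b i then c i else 0)
sumℤ-if zero    b c = refl
sumℤ-if (suc m) b c =
  trans (cong₂ ℤ._+_ (sym (if-float ℤ.+_ (b zero))) (sumℤ-if m (b ∘ suc) (c ∘ suc)))
        (sym (ℤP.pos-+ (if b zero then c zero else 0) _))

odd : ℕ → Bool
odd zero          = false
odd (suc zero)    = true
odd (suc (suc t)) = odd t

odd+double : ∀ t → (if odd t then 1 else 0) + 2 * ⌊ t /2⌋ ≡ t
odd+double zero          = refl
odd+double (suc zero)    = refl
odd+double (suc (suc t)) =
  trans (unfold (if odd t then 1 else 0) ⌊ t /2⌋) (cong (λ n → suc (suc n)) (odd+double t))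
  where
  unfold : ∀ p h → p + 2 * suc h ≡ suc (suc (p + 2 * h))
  unfold = solve-∀

binary : ∀ {k} → ℕ → Fin k → Bool
binary t zero    = odd t
binary t (suc j) = binary ⌊ t /2⌋ j

sumℕ-*ˡ : ∀ m c (f : Fin m → ℕ) → sumℕ m (λ i → c * f i) ≡ c * sumℕ m f
sumℕ-*ˡ zero    c f = sym (*-zeroʳ c)
sumℕ-*ˡ (suc m) c f =
  trans (cong (c * f zero +_) (sumℕ-*ˡ m c (f ∘ suc))) (sym (*-distribˡ-+ c (f zero) _))

binary-value : ∀ k t → t < 2 ^ k → sumℕ k (λ j → if binary t j then 2 ^ toℕ j else 0) ≡ t
binary-value zero    zero    _ = refl
binary-value zero    (suc t) (s≤s ())
binary-value (suc k) t t<2^k+1 = begin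
  parity + sumℕ k (λ j → if binary ⌊ t /2⌋ j then 2 * 2 ^ toℕ j else 0)
    ≡⟨ cong (parity +_) (sumℕ-cong k (λ j → sym (if-float (2 *_) (binary ⌊ t /2⌋ j)))) ⟩
  parity + sumℕ k (λ j → 2 * (if binary ⌊ t /2⌋ j then 2 ^ toℕ j else 0))
    ≡⟨ cong (parity +_) (sumℕ-*ˡ k 2 _) ⟩
  parity + 2 * sumℕ k (λ j → if binary ⌊ t /2⌋ j then 2 ^ toℕ j else 0)
    ≡⟨ cong (λ s → parity + 2 * s) (binary-value k ⌊ t /2⌋ half<) ⟩
  parity + 2 * ⌊ t /2⌋
    ≡⟨ odd+double t ⟩
  t ∎
  where
  open ≡-Reasoning
  parity = if odd t then 1 else 0
  half< : ⌊ t /2⌋ < 2 ^ k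
  half< = *-cancelˡ-< 2 _ _
            (≤-<-trans (m≤n+m _ parity) (subst (_< 2 * 2 ^ k) (sym (odd+double t)) t<2^k+1))

1+n≤2^n : ∀ n → 1 + n ≤ 2 ^ n
1+n≤2^n zero    = ≤-refl
1+n≤2^n (suc n) = begin
  2 + n          ≤⟨ +-monoʳ-≤ 1 (1+n≤2^n n) ⟩
  1 + 2 ^ n      ≤⟨ +-monoˡ-≤ (2 ^ n) (m^n>0 2 n) ⟩
  2 ^ n + 2 ^ n  ≡⟨ cong (2 ^ n +_) (sym (+-identityʳ (2 ^ n))) ⟩
  2 ^ suc n      ∎
  where open ≤-Reasoning

-- With j = a + 2b + 1, the linear function is at most j² < (j + 1)² ≤ 2^(2j).
linear<2^ : ∀ a b → a + b * (2 * (a + 2 * b + 1)) < 2 ^ (2 * (a + 2 * b + 1))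
linear<2^ a b = begin-strict
  a + b * (2 * j)                  ≤⟨ +-monoˡ-≤ (b * (2 * j)) a≤j*a ⟩
  j * a + b * (2 * j)              ≡⟨ cong (j * a +_) (swap b j) ⟩
  j * a + j * (2 * b)              <⟨ s≤s (m≤m+n _ (3 * j)) ⟩
  suc (j * a + j * (2 * b) + 3 * j) ≡⟨ square a b ⟨
  suc j * suc j                    ≤⟨ *-mono-≤ (1+n≤2^n j) (1+n≤2^n j) ⟩
  2 ^ j * 2 ^ j                    ≡⟨ ^-distribˡ-+-* 2 j j ⟨
  2 ^ (j + j)                      ≡⟨ cong (λ i → 2 ^ (j + i)) (+-identityʳ j) ⟨
  2 ^ (2 * j)                      ∎
  where
  open ≤-Reasoning
  j = a + 2 * b + 1
  a≤j*a : a ≤ j * a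
  a≤j*a = subst (_≤ j * a) (*-identityˡ a) (*-monoˡ-≤ a (subst (1 ≤_) (+-comm 1 (a + 2 * b)) (s≤s z≤n)))
  swap : ∀ b j → b * (2 * j) ≡ j * (2 * b)
  swap = solve-∀
  square : ∀ a b → suc (a + 2 * b + 1) * suc (a + 2 * b + 1) ≡
    suc ((a + 2 * b + 1) * a + (a + 2 * b + 1) * (2 * b) + 3 * (a + 2 * b + 1))
  square = solve-∀

-- For k = 2^p we have (3 + k)^d ≤ 2^((2 + p)d), and linear<2^ keeps c + 1 + (2 + p)d below k + 1.
polynomial<2^ : ∀ c d → ∃ λ k → c * (3 + k) ^ d + c < 2 ^ suc k
polynomial<2^ c d = 2 ^ p , (begin-strict
  c * (3 + 2 ^ p) ^ d + c    ≤⟨ +-monoˡ-≤ c (*-monoʳ-≤ c (^-monoˡ-≤ d 3+2^p≤)) ⟩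
  c * X′ + c                 ≡⟨ cong (λ z → c * z + c) (^-*-assoc 2 (2 + p) d) ⟩
  c * X + c                  ≤⟨ +-monoʳ-≤ (c * X) c≤c*X ⟩
  c * X + c * X              ≤⟨ +-mono-≤ (*-monoˡ-≤ X c≤2^c) (*-monoˡ-≤ X c≤2^c) ⟩
  2 ^ c * X + 2 ^ c * X      ≡⟨ doubling (2 ^ c) X ⟩
  2 ^ suc c * X              ≡⟨ ^-distribˡ-+-* 2 (suc c) ((2 + p) * d) ⟨
  2 ^ (suc c + (2 + p) * d)  <⟨ ^-monoʳ-< 2 (s≤s (s≤s z≤n)) (s≤s exponent<) ⟩
  2 ^ suc (2 ^ p)            ∎)
  where
  open ≤-Reasoning
  p = 2 * (c + 2 * d + 2 * d + 1)
  X′ = (2 ^ (2 + p)) ^ d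
  X = 2 ^ ((2 + p) * d)
  3+2^p≤ : 3 + 2 ^ p ≤ 2 ^ (2 + p)
  3+2^p≤ = subst (3 + 2 ^ p ≤_) (quadruple (2 ^ p)) (+-monoˡ-≤ (2 ^ p) (*-monoʳ-≤ 3 (m^n>0 2 p)))
    where
    quadruple : ∀ y → 3 * y + y ≡ 2 * (2 * y)
    quadruple = solve-∀
  c≤c*X : c ≤ c * X
  c≤c*X = subst (_≤ c * X) (*-identityʳ c) (*-monoʳ-≤ c (m^n>0 2 ((2 + p) * d)))
  c≤2^c : c ≤ 2 ^ c
  c≤2^c = ≤-trans (n≤1+n c) (1+n≤2^n c)
  doubling : ∀ y X → y * X + y * X ≡ 2 * y * X
  doubling = solve-∀
  exponent< : c + (2 + p) * d < 2 ^ p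
  exponent< = subst (_< 2 ^ p) (sym (regroup c d p)) (linear<2^ (c + 2 * d) d)
    where
    regroup : ∀ c d p → c + (2 + p) * d ≡ c + 2 * d + d * p
    regroup = solve-∀

/-≤-/1 : ∀ a r k → a ≤ r * suc k → (ℤ.+ a) ℚ./ suc k ℚ.≤ (ℤ.+ r) ℚ./ 1
/-≤-/1 a r k a≤rk = ℚP.toℚᵘ-cancel-≤ (begin
  ℚ.toℚᵘ ((ℤ.+ a) ℚ./ suc k) ≃⟨ ℚP.toℚᵘ-fromℚᵘ (mkℚᵘ (ℤ.+ a) k) ⟩
  mkℚᵘ (ℤ.+ a) k             ≤⟨ ℚᵘ.*≤* (subst₂ ℤ._≤_ (ℤP.pos-* a 1) (ℤP.pos-* r (suc k))
                                (ℤ.+≤+ (subst (_≤ r * suc k) (sym (*-identityʳ a)) a≤rk))) ⟩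
  mkℚᵘ (ℤ.+ r) 0             ≃⟨ ℚP.toℚᵘ-fromℚᵘ (mkℚᵘ (ℤ.+ r) 0) ⟨
  ℚ.toℚᵘ ((ℤ.+ r) ℚ./ 1)    ∎)
  where open ℚᵘP.≤-Reasoning

/1-cancel-≤ : ∀ a b → (ℤ.+ a) ℚ./ 1 ℚ.≤ (ℤ.+ b) ℚ./ 1 → a ≤ b
/1-cancel-≤ a b a/1≤b/1 with ℚᵘP.≤-respʳ-≃ (ℚP.toℚᵘ-fromℚᵘ (mkℚᵘ (ℤ.+ b) 0))
                                (ℚᵘP.≤-respˡ-≃ (ℚP.toℚᵘ-fromℚᵘ (mkℚᵘ (ℤ.+ a) 0)) (ℚP.toℚᵘ-mono-≤ a/1≤b/1))
... | ℚᵘ.*≤* a*1≤b*1 = subst₂ _≤_ (*-identityʳ a) (*-identityʳ b)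
                         (ℤP.drop‿+≤+ (subst₂ ℤ._≤_ (sym (ℤP.pos-* a 1)) (sym (ℤP.pos-* b 1)) a*1≤b*1))

Near : ℕ → ℕ → ℕ → Set
Near c a b = a ≤ b + c × b ≤ a + c

Near-+ˡ : ∀ d {c a b} → Near c a b → Near c (d + a) (d + b)
Near-+ˡ d {c} {a} {b} (a≤b+c , b≤a+c) =
  subst (d + a ≤_) (sym (+-assoc d b c)) (+-monoʳ-≤ d a≤b+c) ,
  subst (d + b ≤_) (sym (+-assoc d a c)) (+-monoʳ-≤ d b≤a+c)

sumᵖ : ∀ {n} → Fin n × Fin n → ℕ
sumᵖ (u , v) = toℕ u + toℕ v

-- Walks in an instance

module Walks (I : Instance) where
  open Instance I

  _++ʷ_ : ∀ {S u v w a b} → Walk I S u v a → Walk I S v w b → Walk I S u w (a + b)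
  nil ++ʷ q = q
  _++ʷ_ {S} {u} {w = w} {b = b} (cons {ℓ = a} e s l p) q =
    subst (Walk I S u w) (sym (+-assoc (c2 e) a b)) (cons e s l (p ++ʷ q))

  edgeWalk : ∀ {S u w} e → S e ≡ true → Link I e u w → Walk I S u w (c2 e)
  edgeWalk {S} {u} {w} e s l = subst (Walk I S u w) (+-identityʳ (c2 e)) (cons e s l nil)

  Link-sym : ∀ {e u w} → Link I e u w → Link I e w u
  Link-sym (inj₁ e≡uw) = inj₂ e≡uw
  Link-sym (inj₂ e≡wu) = inj₁ e≡wu

  reverse : ∀ {S u v ℓ} → Walk I S u v ℓ → Walk I S v u ℓ
  reverse nil = nil
  reverse {S} {u} {v} (cons {ℓ = a} e s l p) =
    subst (Walk I S v u) (+-comm a (c2 e)) (reverse p ++ʷ edgeWalk e s (Link-sym l))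

  Link-sum : ∀ e {u w} → Link I e u w → sumᵖ (ends e) ≡ toℕ u + toℕ w
  Link-sum e (inj₁ refl) = refl
  Link-sum e {u} {w} (inj₂ refl) = +-comm (toℕ w) (toℕ u)

  Link-near : ∀ e {u w c} (f : Fin n → ℕ) → Near c (f (proj₁ (ends e))) (f (proj₂ (ends e))) →
    Link I e u w → Near c (f u) (f w)
  Link-near e f near            (inj₁ refl) = near
  Link-near e f (p≤q+c , q≤p+c) (inj₂ refl) = q≤p+c , p≤q+c

  Link-walk : ∀ {S} e {u w ℓ} → Walk I S (proj₁ (ends e)) (proj₂ (ends e)) ℓ →
    Link I e u w → Walk I S u w ℓ
  Link-walk e p (inj₁ refl) = p
  Link-walk e p (inj₂ refl) = reverse p

  Walk-⊆ : ∀ {S S′ u v ℓ} → (∀ e → S e ≡ true → S′ e ≡ true) → Walk I S u v ℓ → Walk I S′ u v ℓ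
  Walk-⊆ S⊆S′ nil            = nil
  Walk-⊆ S⊆S′ (cons e s l p) = cons e (S⊆S′ e s) l (Walk-⊆ S⊆S′ p)

  connected-from : ∀ {S} r → (∀ v → ∃ (Walk I S r v)) → Connected I S
  connected-from r reach u v =
    proj₁ (reach u) + proj₁ (reach v) , reverse (proj₂ (reach u)) ++ʷ proj₂ (reach v)

  Link? : ∀ e u w → Dec (Link I e u w)
  Link? e u w = ProdP.≡-dec Fin._≟_ Fin._≟_ (ends e) (u , w)
          ⊎-dec ProdP.≡-dec Fin._≟_ Fin._≟_ (ends e) (w , u)

  FirstStep : EdgeSet m → Fin n → Fin n → ℕ → Set
  FirstStep S u v j = ∃₂ λ e w → S e ≡ true × Link I e u w ×
                                 Σ (c2 e ≤ j) λ _ → Walk I S w v (j ∸ c2 e)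

  Walk-uncons : ∀ {S u v ℓ} → Walk I S u v ℓ → (u ≡ v × ℓ ≡ 0) ⊎ FirstStep S u v ℓ
  Walk-uncons nil = inj₁ (refl , refl)
  Walk-uncons {S} {v = v} (cons {w = w} {ℓ = a} e s l p) =
    inj₂ (e , w , s , l , m≤m+n (c2 e) a , subst (Walk I S w v) (sym (m+n∸m≡n (c2 e) a)) p)

  Walk-cons : ∀ {S u v ℓ} → (u ≡ v × ℓ ≡ 0) ⊎ FirstStep S u v ℓ → Walk I S u v ℓ
  Walk-cons (inj₁ (refl , refl)) = nil
  Walk-cons {S} {u} {v} (inj₂ (e , w , s , l , c2e≤ℓ , p)) =
    subst (Walk I S u v) (m+[n∸m]≡n c2e≤ℓ) (cons e s l p)

  -- Decidable by recursion on the length, since every edge has positive length.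
  Walk? : ∀ S u v ℓ → Dec (Walk I S u v ℓ)
  Walk? S u v ℓ = <-rec (λ ℓ → ∀ u → Dec (Walk I S u v ℓ)) decide ℓ u
    where
    decide : ∀ ℓ → (∀ {j} → j < ℓ → ∀ u → Dec (Walk I S u v j)) → ∀ u → Dec (Walk I S u v ℓ)
    decide ℓ shorter u = map′ Walk-cons Walk-uncons
      ((u Fin.≟ v) ×-dec (ℓ ≟ 0) ⊎-dec FinP.any? λ e → FinP.any? λ w → step? e w)
      where
      step? : ∀ e w → Dec (S e ≡ true × Link I e u w × Σ (c2 e ≤ ℓ) λ _ → Walk I S w v (ℓ ∸ c2 e))
      step? e w with S e Data.Bool.≟ true | Link? e u w | c2 e ≤? ℓ
      ... | no ¬s | _     | _      = no λ (s , _) → ¬s s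
      ... | yes s | no ¬l | _      = no λ (_ , l , _) → ¬l l
      ... | yes s | yes l | no ¬le = no λ (_ , _ , le , _) → ¬le le
      ... | yes s | yes l | yes le with shorter (∸-monoʳ-< {ℓ} {c2 e} {0} (c2-pos e) le) w
      ...   | yes p = yes (s , l , le , p)
      ...   | no ¬p = no λ (_ , _ , _ , p) → ¬p p

  shortest : ∀ {S u v ℓ} → Walk I S u v ℓ → ∃ (IsDist I S u v)
  shortest {S} {u} {v} p = least (Walk? S u v) p

  Walk-potential : ∀ {S u v ℓ} (φ : Fin n → ℕ) →
    (∀ e {u w} → S e ≡ true → Link I e u w → φ w ≤ φ u + c2 e) →
    Walk I S u v ℓ → φ v ≤ φ u + ℓ
  Walk-potential φ step nil = m≤m+n _ 0
  Walk-potential {u = u} {v} φ step (cons {w = w} {ℓ = a} e s l p) = begin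
    φ v             ≤⟨ Walk-potential φ step p ⟩
    φ w + a         ≤⟨ +-monoˡ-≤ a (step e s l) ⟩
    φ u + c2 e + a  ≡⟨ +-assoc (φ u) (c2 e) a ⟩
    φ u + (c2 e + a) ∎
    where open ≤-Reasoning

  Walk-dilate : ∀ {S u v ℓ} D → (∀ e {u w} → Link I e u w → ∃ λ ℓ → Walk I S u w ℓ × ℓ ≤ D * c2 e) →
    Walk I (allEdges I) u v ℓ → ∃ λ ℓ′ → Walk I S u v ℓ′ × ℓ′ ≤ D * ℓ
  Walk-dilate D short nil = 0 , nil , z≤n
  Walk-dilate D short (cons {ℓ = a} e _ l p) with short e l | Walk-dilate D short p
  ... | ℓ₁ , p₁ , ℓ₁≤ | ℓ₂ , p₂ , ℓ₂≤ =
    ℓ₁ + ℓ₂ , p₁ ++ʷ p₂ , subst (ℓ₁ + ℓ₂ ≤_) (sym (*-distribˡ-+ D (c2 e) a)) (+-mono-≤ ℓ₁≤ ℓ₂≤)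

-- Chords of the outer drawing

ShortChord : ℕ → ℕ → Set
ShortChord p q = q ≡ suc p ⊎ ∃ λ j → p ≡ 3 * j × q ≡ 2 + 3 * j

toℕᵖ : ∀ {n} → Fin n × Fin n → ℕ × ℕ
toℕᵖ (u , v) = toℕ u , toℕ v

ShortChordᵖ : ℕ × ℕ → Set
ShortChordᵖ (p , q) = ShortChord p q

ShortChord⇒< : ∀ {p q} → ShortChord p q → p < q
ShortChord⇒< (inj₁ refl)             = ≤-refl
ShortChord⇒< (inj₂ (j , refl , refl)) = m<n+m (3 * j) {2} (s≤s z≤n)

ShortChord⇒Near : ∀ {p q} → ShortChord p q → Near 2 p q
ShortChord⇒Near {p} (inj₁ refl)         =
  m≤n⇒m≤n+o 2 (n≤1+n p) , subst (suc p ≤_) (+-comm 2 p) (n≤1+n (suc p))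
ShortChord⇒Near (inj₂ (j , refl , refl)) = m≤n⇒m≤n+o 2 (m≤n+m _ 2) , ≤-reflexive (+-comm 2 _)

Crossing : ℕ → ℕ → ℕ → ℕ → Set
Crossing p q x y = p < x × x < q × (y < p ⊎ q < y)

-- The chords of the instance drawn on positions 0, …, 3K: chain edges and the long edge (0, 3K).
Shape : ℕ → ℕ → ℕ → Set
Shape K p q = ShortChord p q ⊎ (p ≡ 0 × q ≡ 3 * K)

Shape⇒≤ : ∀ {K p q} → Shape K p q → p ≤ q
Shape⇒≤ (inj₁ (inj₁ refl))             = n≤1+n _
Shape⇒≤ (inj₁ (inj₂ (j , refl , refl))) = m≤n+m _ 2
Shape⇒≤ (inj₂ (refl , refl))            = z≤n

+3*-mod-3 : ∀ r j → (r + 3 * j) % 3 ≡ r % 3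
+3*-mod-3 r j = trans (cong (λ z → (r + z) % 3) (*-comm 3 j)) ([m+kn]%n≡m%n r j 3)

1+3*≢3* : ∀ i j → 1 + 3 * j ≢ 3 * i
1+3*≢3* i j eq with trans (sym (+3*-mod-3 1 j)) (trans (cong (_% 3) eq) (+3*-mod-3 0 i))
... | ()

1+3*≢2+3* : ∀ i j → 1 + 3 * j ≢ 2 + 3 * i
1+3*≢2+3* i j eq with trans (sym (+3*-mod-3 1 j)) (trans (cong (_% 3) eq) (+3*-mod-3 2 i))
... | ()

Beside : ℕ → ℕ → Set
Beside j y = y ≡ 3 * j ⊎ y ≡ 2 + 3 * j

Shape-middleˡ : ∀ {K p q j} → Shape K p q → p ≡ 1 + 3 * j → Beside j q
Shape-middleˡ (inj₁ (inj₁ refl))             p≡ = inj₂ (cong suc p≡)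
Shape-middleˡ {j = j} (inj₁ (inj₂ (i , refl , refl))) p≡ = ⊥-elim (1+3*≢3* i j (sym p≡))
Shape-middleˡ (inj₂ (refl , refl))            ()

Shape-middleʳ : ∀ {K p q j} → Shape K p q → q ≡ 1 + 3 * j → Beside j p
Shape-middleʳ (inj₁ (inj₁ refl))             q≡ = inj₁ (suc-injective q≡)
Shape-middleʳ {j = j} (inj₁ (inj₂ (i , refl , refl))) q≡ = ⊥-elim (1+3*≢2+3* i j (sym q≡))
Shape-middleʳ {K} {j = j} (inj₂ (refl , refl)) q≡ = ⊥-elim (1+3*≢3* K j (sym q≡))

-- Strictly inside a chord lies at most a middle position 3j+1, whose chords end at 3j or 3j+2;
-- nothing lies outside the long chord.
Crossing-impossible : ∀ {K p q x y} → Shape K p q → (∀ {j} → x ≡ 1 + 3 * j → Beside j y) → y ≤ 3 * K →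
  ¬ Crossing p q x y
Crossing-impossible (inj₁ (inj₁ refl)) _ _ (p<x , x<q , _) = <⇒≱ p<x (s≤s⁻¹ x<q)
Crossing-impossible (inj₁ (inj₂ (j , refl , refl))) beside _ (p<x , x<q , y-out)
  with beside {j} (≤-antisym (s≤s⁻¹ x<q) p<x) | y-out
... | inj₁ refl | inj₁ y<p = <-irrefl refl y<p
... | inj₁ refl | inj₂ q<y = <⇒≱ q<y (m≤n+m _ 2)
... | inj₂ refl | inj₁ y<p = <⇒≱ y<p (m≤n+m _ 2)
... | inj₂ refl | inj₂ q<y = <-irrefl refl q<y
Crossing-impossible (inj₂ (refl , refl)) _ y≤ (_ , _ , inj₂ q<y) = <⇒≱ q<y y≤

module _ (I : Instance) where
  Crosses⇒Crossing : ∀ {p q c d} → p ≤ q → Crosses I p q c d → Crossing p q c d ⊎ Crossing p q d c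
  Crosses⇒Crossing p≤q cr rewrite m≤n⇒m⊓n≡m p≤q | m≤n⇒m⊔n≡n p≤q with cr
  ... | inj₁ ((p<c , c<q) , d-out) = inj₁ (p<c , c<q , d-out)
  ... | inj₂ ((p<d , d<q) , c-out) = inj₂ (p<d , d<q , c-out)

  Shape-no-crossing : ∀ {K p q c d} → Shape K p q → Shape K c d → c ≤ 3 * K → d ≤ 3 * K →
    ¬ Crosses I p q c d
  Shape-no-crossing {K} sh₁ sh₂ c≤ d≤ cr with Crosses⇒Crossing (Shape⇒≤ {K} sh₁) cr
  ... | inj₁ cross = Crossing-impossible {K} sh₁ (λ {j} → Shape-middleˡ {K} {j = j} sh₂) d≤ cross
  ... | inj₂ cross = Crossing-impossible {K} sh₁ (λ {j} → Shape-middleʳ {K} {j = j} sh₂) c≤ cross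

-- Chains of gadgets

-- A chain of k gadgets: gadget j has vertices entry j, middle j, exit j at positions 3j, 3j+1, 3j+2,
-- and its four edges, of the roles below, are Fin.combine j r at position 4j + r.  Chains are defined
-- by recursion on k (the tail shifted by 3 vertices and 4 edges); the *-combine lemmas read them
-- back gadget by gadget.
pattern direct  = zero
pattern detour₁ = suc zero
pattern detour₂ = suc (suc zero)
pattern bridge  = suc (suc (suc zero))
pattern shiftᵉ e = suc (suc (suc (suc e)))

#V : ℕ → ℕ
#V k = suc (k * 3)

shiftᵛ : ∀ {k} → Fin (#V k) → Fin (#V (suc k))
shiftᵛ v = suc (suc (suc v))

entry : ∀ {k} → Fin (suc k) → Fin (#V k)
entry zero              = zero
entry {suc k} (suc j)   = shiftᵛ {k} (entry j)

middle exit : ∀ {k} → Fin k → Fin (#V k)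
middle {suc k} zero    = suc zero
middle {suc k} (suc j) = shiftᵛ {k} (middle j)
exit   {suc k} zero    = suc (suc zero)
exit   {suc k} (suc j) = shiftᵛ {k} (exit j)

shiftᵖ : ∀ k → Fin (#V k) × Fin (#V k) → Fin (#V (suc k)) × Fin (#V (suc k))
shiftᵖ k (u , v) = shiftᵛ {k} u , shiftᵛ {k} v

last : ∀ k → Fin (#V k)
last k = entry (Fin.fromℕ k)

gadgetEnds : ∀ {k} → Fin k → Fin 4 → Fin (#V k) × Fin (#V k)
gadgetEnds j direct  = entry (Fin.inject₁ j) , exit j
gadgetEnds j detour₁ = entry (Fin.inject₁ j) , middle j
gadgetEnds j detour₂ = middle j , exit j
gadgetEnds j bridge  = exit j , entry (suc j)

gadgetLength : ℕ → ℕ → Fin 4 → ℕ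
gadgetLength L x direct  = L
gadgetLength L x detour₁ = L
gadgetLength L x detour₂ = x
gadgetLength L x bridge  = 1

gadgetCost : ℕ → Fin 4 → ℕ
gadgetCost x direct  = x
gadgetCost x detour₁ = 0
gadgetCost x detour₂ = 0
gadgetCost x bridge  = 0

chainEnds : ∀ k → Fin (k * 4) → Fin (#V k) × Fin (#V k)
chainEnds (suc k) direct     = gadgetEnds {suc k} zero direct
chainEnds (suc k) detour₁    = gadgetEnds {suc k} zero detour₁
chainEnds (suc k) detour₂    = gadgetEnds {suc k} zero detour₂
chainEnds (suc k) bridge     = gadgetEnds {suc k} zero bridge
chainEnds (suc k) (shiftᵉ e) = shiftᵖ k (chainEnds k e)

chainLength : ∀ k → ℕ → (Fin k → ℕ) → Fin (k * 4) → ℕ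
chainLength (suc k) L x direct     = gadgetLength L (x zero) direct
chainLength (suc k) L x detour₁    = gadgetLength L (x zero) detour₁
chainLength (suc k) L x detour₂    = gadgetLength L (x zero) detour₂
chainLength (suc k) L x bridge     = gadgetLength L (x zero) bridge
chainLength (suc k) L x (shiftᵉ e) = chainLength k L (x ∘ suc) e

chainCost : ∀ k → (Fin k → ℕ) → Fin (k * 4) → ℕ
chainCost (suc k) x direct     = gadgetCost (x zero) direct
chainCost (suc k) x detour₁    = gadgetCost (x zero) detour₁
chainCost (suc k) x detour₂    = gadgetCost (x zero) detour₂
chainCost (suc k) x bridge     = gadgetCost (x zero) bridge
chainCost (suc k) x (shiftᵉ e) = chainCost k (x ∘ suc) e

data VertexKind {k} : Fin (#V k) → Set where
  at-entry  : ∀ j → VertexKind (entry {k} j)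
  at-middle : ∀ j → VertexKind (middle {k} j)
  at-exit   : ∀ j → VertexKind (exit {k} j)

vertexKind : ∀ k v → VertexKind {k} v
vertexKind zero    zero                = at-entry zero
vertexKind (suc k) zero                = at-entry zero
vertexKind (suc k) (suc zero)          = at-middle zero
vertexKind (suc k) (suc (suc zero))    = at-exit zero
vertexKind (suc k) (suc (suc (suc v))) with vertexKind k v
... | at-entry j  = at-entry (suc j)
... | at-middle j = at-middle (suc j)
... | at-exit j   = at-exit (suc j)

chainEnds-combine : ∀ k (j : Fin k) r → chainEnds k (Fin.combine j r) ≡ gadgetEnds j r
chainEnds-combine (suc k) zero    direct  = refl
chainEnds-combine (suc k) zero    detour₁ = refl
chainEnds-combine (suc k) zero    detour₂ = refl
chainEnds-combine (suc k) zero    bridge  = refl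
chainEnds-combine (suc k) (suc j) direct  = cong (shiftᵖ k) (chainEnds-combine k j direct)
chainEnds-combine (suc k) (suc j) detour₁ = cong (shiftᵖ k) (chainEnds-combine k j detour₁)
chainEnds-combine (suc k) (suc j) detour₂ = cong (shiftᵖ k) (chainEnds-combine k j detour₂)
chainEnds-combine (suc k) (suc j) bridge  = cong (shiftᵖ k) (chainEnds-combine k j bridge)

chainLength-combine : ∀ k L x (j : Fin k) r → chainLength k L x (Fin.combine j r) ≡ gadgetLength L (x j) r
chainLength-combine (suc k) L x zero    direct  = refl
chainLength-combine (suc k) L x zero    detour₁ = refl
chainLength-combine (suc k) L x zero    detour₂ = refl
chainLength-combine (suc k) L x zero    bridge  = refl
chainLength-combine (suc k) L x (suc j) r       = chainLength-combine k L (x ∘ suc) j r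

chainCost-combine : ∀ k x (j : Fin k) r → chainCost k x (Fin.combine j r) ≡ gadgetCost (x j) r
chainCost-combine (suc k) x zero    direct  = refl
chainCost-combine (suc k) x zero    detour₁ = refl
chainCost-combine (suc k) x zero    detour₂ = refl
chainCost-combine (suc k) x zero    bridge  = refl
chainCost-combine (suc k) x (suc j) r       = chainCost-combine k (x ∘ suc) j r

gadgetSelect : Bool → Fin 4 → Bool
gadgetSelect b direct  = b
gadgetSelect b detour₁ = true
gadgetSelect b detour₂ = true
gadgetSelect b bridge  = true

gadgetSelect-false : ∀ {b} r → gadgetSelect b r ≡ false → r ≡ direct
gadgetSelect-false direct  _  = refl
gadgetSelect-false detour₁ ()
gadgetSelect-false detour₂ ()
gadgetSelect-false bridge  ()

chainSelect : ∀ k → (Fin k → Bool) → Fin (k * 4) → Bool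
chainSelect (suc k) δ direct     = gadgetSelect (δ zero) direct
chainSelect (suc k) δ detour₁    = gadgetSelect (δ zero) detour₁
chainSelect (suc k) δ detour₂    = gadgetSelect (δ zero) detour₂
chainSelect (suc k) δ bridge     = gadgetSelect (δ zero) bridge
chainSelect (suc k) δ (shiftᵉ e) = chainSelect k (δ ∘ suc) e

chainSelect-combine : ∀ k δ (j : Fin k) r → chainSelect k δ (Fin.combine j r) ≡ gadgetSelect (δ j) r
chainSelect-combine (suc k) δ zero    direct  = refl
chainSelect-combine (suc k) δ zero    detour₁ = refl
chainSelect-combine (suc k) δ zero    detour₂ = refl
chainSelect-combine (suc k) δ zero    bridge  = refl
chainSelect-combine (suc k) δ (suc j) r       = chainSelect-combine k (δ ∘ suc) j r

gap : ℕ → Bool → ℕ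
gap x b = if b then 0 else x

span : ℕ → ℕ → Bool → ℕ
span L x b = L + gap x b + 1

-- The length, from the first vertex, of the path along the chain that uses the direct edges σ selects.
potential : ∀ k → ℕ → (Fin k → ℕ) → (Fin (k * 4) → Bool) → Fin (#V k) → ℕ
potential zero    L x σ _                   = 0
potential (suc k) L x σ zero                = 0
potential (suc k) L x σ (suc zero)          = L
potential (suc k) L x σ (suc (suc zero))    = L + gap (x zero) (σ direct)
potential (suc k) L x σ (suc (suc (suc v))) =
  span L (x zero) (σ direct) + potential k L (x ∘ suc) (λ e → σ (shiftᵉ e)) v

potential-zero : ∀ k L x σ → potential k L x σ zero ≡ 0
potential-zero zero    L x σ = refl
potential-zero (suc k) L x σ = refl

potential-exit : ∀ k L x σ (j : Fin k) →
  potential k L x σ (exit j) ≡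
  potential k L x σ (entry (Fin.inject₁ j)) + L + gap (x j) (σ (Fin.combine j direct))
potential-exit (suc k) L x σ zero    = refl
potential-exit (suc k) L x σ (suc j) =
  trans (cong (span L (x zero) (σ direct) +_) (potential-exit k L (x ∘ suc) _ j))
        (reassoc (span L (x zero) (σ direct)) _ L _)
  where
  reassoc : ∀ c a L g → c + (a + L + g) ≡ c + a + L + g
  reassoc = solve-∀

potential-entry-suc : ∀ k L x σ (j : Fin k) →
  potential k L x σ (entry (suc j)) ≡ potential k L x σ (exit j) + 1
potential-entry-suc (suc k) L x σ zero    =
  trans (cong (span L (x zero) (σ direct) +_) (potential-zero k L (x ∘ suc) _)) (+-identityʳ _)
potential-entry-suc (suc k) L x σ (suc j) =
  trans (cong (span L (x zero) (σ direct) +_) (potential-entry-suc k L (x ∘ suc) _ j))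
        (sym (+-assoc (span L (x zero) (σ direct)) _ 1))

potential-entry-step : ∀ k L x σ (j : Fin k) →
  potential k L x σ (entry (suc j)) ≡
  potential k L x σ (entry (Fin.inject₁ j)) + span L (x j) (σ (Fin.combine j direct))
potential-entry-step k L x σ j =
  trans (potential-entry-suc k L x σ j)
        (trans (cong (_+ 1) (potential-exit k L x σ j))
               (reassoc _ L (gap (x j) (σ (Fin.combine j direct)))))
  where
  reassoc : ∀ a L g → a + L + g + 1 ≡ a + (L + g + 1)
  reassoc = solve-∀

L+1≤potential-last : ∀ k L x σ → L + 1 ≤ potential (suc k) L x σ (last (suc k))
L+1≤potential-last k L x σ =
  ≤-trans (+-monoˡ-≤ 1 (m≤m+n L (gap (x zero) (σ direct)))) (m≤m+n (span L (x zero) (σ direct)) _)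

potential-near : ∀ k L x σ e → σ e ≡ true →
  Near (chainLength k L x e) (potential k L x σ (proj₁ (chainEnds k e)))
                             (potential k L x σ (proj₂ (chainEnds k e)))
potential-near (suc k) L x σ direct σe rewrite σe = z≤n , ≤-reflexive (+-identityʳ L)
potential-near (suc k) L x σ detour₁ σe = z≤n , ≤-refl
potential-near (suc k) L x σ detour₂ σe =
  ≤-trans (m≤m+n L _) (m≤m+n _ _) , +-monoʳ-≤ L (gap≤ (x zero) (σ direct))
  where
  gap≤ : ∀ y b → gap y b ≤ y
  gap≤ y true  = z≤n
  gap≤ y false = ≤-refl
potential-near (suc k) L x σ bridge σe
  rewrite potential-zero k L (x ∘ suc) (λ e → σ (shiftᵉ e)) | +-identityʳ (span L (x zero) (σ direct)) =
  ≤-trans (m≤m+n _ 1) (m≤m+n _ 1) , ≤-refl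
potential-near (suc k) L x σ (shiftᵉ e) σe =
  Near-+ˡ (span L (x zero) (σ direct)) (potential-near k L (x ∘ suc) (λ e → σ (shiftᵉ e)) e σe)

selectedCost : ∀ k → (Fin k → ℕ) → (Fin (k * 4) → Bool) → ℕ
selectedCost k x σ = sumℕ (k * 4) (λ e → if σ e then chainCost k x e else 0)

-- Selecting a direct edge trades its cost x_j against x_j of path length, so the sum is constant.
selectedCost+potential : ∀ k L x σ →
  selectedCost k x σ + potential k L x σ (last k) ≡ sumℕ k (λ j → L + x j + 1)
selectedCost+potential zero    L x σ = refl
selectedCost+potential (suc k) L x σ
  rewrite if-eta (σ detour₁) {0} | if-eta (σ detour₂) {0} | if-eta (σ bridge) {0} =
  trans (shuffle (if σ direct then x zero else 0) (gap (x zero) (σ direct)) L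
                 (selectedCost k (x ∘ suc) σ′) (potential k L (x ∘ suc) σ′ (last k)))
        (cong₂ (λ y z → L + y + 1 + z) (cost+gap (x zero) (σ direct))
               (selectedCost+potential k L (x ∘ suc) σ′))
  where
  σ′ = λ e → σ (shiftᵉ e)
  cost+gap : ∀ y b → (if b then y else 0) + gap y b ≡ y
  cost+gap y true  = +-identityʳ y
  cost+gap y false = refl
  shuffle : ∀ a g L c p → a + c + (L + g + 1 + p) ≡ L + (a + g) + 1 + (c + p)
  shuffle = solve-∀

selectedCost-select : ∀ k x δ → selectedCost k x (chainSelect k δ) ≡ sumℕ k (λ j → if δ j then x j else 0)
selectedCost-select zero    x δ = refl
selectedCost-select (suc k) x δ =
  cong ((if δ zero then x zero else 0) +_) (selectedCost-select k (x ∘ suc) (δ ∘ suc))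

toℕ-entry : ∀ {k} (j : Fin (suc k)) → toℕ (entry j) ≡ 3 * toℕ j
toℕ-entry zero            = refl
toℕ-entry {suc k} (suc j) = trans (cong (3 +_) (toℕ-entry j)) (sym (*-suc 3 (toℕ j)))

toℕ-entry-inject₁ : ∀ {k} (j : Fin k) → toℕ (entry (Fin.inject₁ j)) ≡ 3 * toℕ j
toℕ-entry-inject₁ j = trans (toℕ-entry (Fin.inject₁ j)) (cong (3 *_) (FinP.toℕ-inject₁ j))

toℕ-middle : ∀ {k} (j : Fin k) → toℕ (middle j) ≡ 1 + 3 * toℕ j
toℕ-middle {suc k} zero    = refl
toℕ-middle {suc k} (suc j) = trans (cong (3 +_) (toℕ-middle j)) (cong suc (sym (*-suc 3 (toℕ j))))

toℕ-exit : ∀ {k} (j : Fin k) → toℕ (exit j) ≡ 2 + 3 * toℕ j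
toℕ-exit {suc k} zero    = refl
toℕ-exit {suc k} (suc j) = trans (cong (3 +_) (toℕ-exit j)) (cong (2 +_) (sym (*-suc 3 (toℕ j))))

-- The position sum 6j + (2, 1, 3, 5) identifies the edge combine j r of a chain.
roleSum : Fin 4 → Fin 6
roleSum direct  = Fin.# 2
roleSum detour₁ = Fin.# 1
roleSum detour₂ = Fin.# 3
roleSum bridge  = Fin.# 5

roleSum⁻¹ : Fin 6 → Fin 4
roleSum⁻¹ zero                            = direct
roleSum⁻¹ (suc zero)                      = detour₁
roleSum⁻¹ (suc (suc zero))                = direct
roleSum⁻¹ (suc (suc (suc zero)))          = detour₂
roleSum⁻¹ (suc (suc (suc (suc zero))))    = direct
roleSum⁻¹ (suc (suc (suc (suc (suc _))))) = bridge

roleSum-injective : ∀ r r′ → roleSum r ≡ roleSum r′ → r ≡ r′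
roleSum-injective r r′ eq = trans (sym (inverse r)) (trans (cong roleSum⁻¹ eq) (inverse r′))
  where
  inverse : ∀ r → roleSum⁻¹ (roleSum r) ≡ r
  inverse direct  = refl
  inverse detour₁ = refl
  inverse detour₂ = refl
  inverse bridge  = refl

gadgetEnds-sum : ∀ {k} (j : Fin k) r → sumᵖ (gadgetEnds j r) ≡ toℕ (Fin.combine j (roleSum r))
gadgetEnds-sum j r = trans (ends-sum r) (sym (FinP.toℕ-combine j (roleSum r)))
  where
  arith : ∀ a b j → a + 3 * j + (b + 3 * j) ≡ 6 * j + (a + b)
  arith = solve-∀
  ends-sum : ∀ r → sumᵖ (gadgetEnds j r) ≡ 6 * toℕ j + toℕ (roleSum r)
  ends-sum direct  rewrite toℕ-entry-inject₁ j | toℕ-exit j   = arith 0 2 (toℕ j)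
  ends-sum detour₁ rewrite toℕ-entry-inject₁ j | toℕ-middle j = arith 0 1 (toℕ j)
  ends-sum detour₂ rewrite toℕ-middle j | toℕ-exit j = arith 1 2 (toℕ j)
  ends-sum bridge  rewrite toℕ-exit j | toℕ-entry (suc j) | *-suc 3 (toℕ j) = arith 2 3 (toℕ j)

chainEnds-sum : ∀ k (j : Fin k) r → sumᵖ (chainEnds k (Fin.combine j r)) ≡ toℕ (Fin.combine j (roleSum r))
chainEnds-sum k j r = trans (cong sumᵖ (chainEnds-combine k j r)) (gadgetEnds-sum j r)

chainEnds-sum-injective : ∀ k (e e′ : Fin (k * 4)) → sumᵖ (chainEnds k e) ≡ sumᵖ (chainEnds k e′) → e ≡ e′
chainEnds-sum-injective k e e′ same
  with j , r , refl ← FinP.combine-surjective {k} {4} e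
     | j′ , r′ , refl ← FinP.combine-surjective {k} {4} e′
  with j≡j′ , r≡r′ ← FinP.combine-injective j (roleSum r) j′ (roleSum r′)
         (FinP.toℕ-injective (trans (sym (chainEnds-sum k j r)) (trans same (chainEnds-sum k j′ r′))))
  = cong₂ Fin.combine j≡j′ (roleSum-injective r r′ r≡r′)

chainEnds-short : ∀ k e → ShortChordᵖ (toℕᵖ (chainEnds k e))
chainEnds-short k e with j , r , refl ← FinP.combine-surjective {k} {4} e
  rewrite chainEnds-combine k j r = short r
  where
  short : ∀ r → ShortChordᵖ (toℕᵖ (gadgetEnds j r))
  short direct  rewrite toℕ-entry-inject₁ j | toℕ-exit j = inj₂ (toℕ j , refl , refl)
  short detour₁ rewrite toℕ-entry-inject₁ j | toℕ-middle j = inj₁ refl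
  short detour₂ rewrite toℕ-middle j | toℕ-exit j = inj₁ refl
  short bridge  rewrite toℕ-exit j | toℕ-entry (suc j) = inj₁ (*-suc 3 (toℕ j))

incidence : ∀ {n} → Fin n × Fin n → Fin n → ℕ
incidence (p , q) v = if ⌊ p Fin.≟ v ⌋ ∨ ⌊ q Fin.≟ v ⌋ then 1 else 0

incidence≤1 : ∀ {n} (p : Fin n × Fin n) v → incidence p v ≤ 1
incidence≤1 (p , q) v with ⌊ p Fin.≟ v ⌋ ∨ ⌊ q Fin.≟ v ⌋
... | true  = ≤-refl
... | false = z≤n

incidence-other : ∀ {n} {a b v : Fin n} → v ≢ a → v ≢ b → incidence (a , b) v ≡ 0
incidence-other {a = a} {b} {v} v≢a v≢b =
  cong₂ (λ x y → if x ∨ y then 1 else 0) (not-equal (v≢a ∘ sym)) (not-equal (v≢b ∘ sym))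
  where
  not-equal : ∀ {c} → c ≢ v → ⌊ c Fin.≟ v ⌋ ≡ false
  not-equal {c} c≢v = trans (isYes≗does (c Fin.≟ v)) (dec-false (c Fin.≟ v) c≢v)

≟-shiftᵛ : ∀ {k} (a v : Fin (#V k)) → ⌊ shiftᵛ {k} a Fin.≟ shiftᵛ {k} v ⌋ ≡ ⌊ a Fin.≟ v ⌋
≟-shiftᵛ a v = trans (⌊⌋-map′ _ _ _) (trans (⌊⌋-map′ _ _ _) (⌊⌋-map′ _ _ (a Fin.≟ v)))

incidence-shift : ∀ k p v → incidence (shiftᵖ k p) (shiftᵛ {k} v) ≡ incidence p v
incidence-shift k (a , b) v =
  cong₂ (λ x y → if x ∨ y then 1 else 0) (≟-shiftᵛ {k} a v) (≟-shiftᵛ {k} b v)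

chainDegree : ∀ k → Fin (#V k) → ℕ
chainDegree k v = sumℕ (k * 4) (λ e → incidence (chainEnds k e) v)

chainDegree-shift : ∀ k v →
  sumℕ (k * 4) (λ e → incidence (chainEnds (suc k) (shiftᵉ e)) (shiftᵛ {k} v)) ≡ chainDegree k v
chainDegree-shift k v = sumℕ-cong (k * 4) (λ e → incidence-shift k (chainEnds k e) v)

-- The end vertices of a chain keep a free slot for the long edge.
ChainDegrees : ℕ → Set
ChainDegrees k = (∀ v → chainDegree k v ≤ 3) × chainDegree k zero ≤ 2 × chainDegree k (last k) ≤ 1

chainDegrees : ∀ k → ChainDegrees k
chainDegrees zero    = (λ _ → z≤n) , z≤n , z≤n
chainDegrees (suc k) with chainDegrees k
... | ≤3 , first≤2 , last≤1 = all≤3 , first≤2′ , last≤1′ k last≤1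
  where
  no-tail : sumℕ (k * 4) (λ _ → 0) ≤ 0
  no-tail = ≤-reflexive (sumℕ-zero (k * 4))
  all≤3 : ∀ v → chainDegree (suc k) v ≤ 3
  all≤3 zero                      = s≤s (s≤s (≤-trans no-tail z≤n))
  all≤3 (suc zero)                = s≤s (s≤s (≤-trans no-tail z≤n))
  all≤3 (suc (suc zero))          = s≤s (s≤s (s≤s no-tail))
  all≤3 (suc (suc (suc zero)))    = s≤s (subst (_≤ 2) (sym (chainDegree-shift k zero)) first≤2)
  all≤3 (suc (suc (suc (suc v)))) = subst (_≤ 3) (sym (chainDegree-shift k (suc v))) (≤3 (suc v))
  first≤2′ : chainDegree (suc k) zero ≤ 2
  first≤2′ = s≤s (s≤s no-tail)
  last≤1′ : ∀ k → chainDegree k (last k) ≤ 1 → chainDegree (suc k) (last (suc k)) ≤ 1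
  last≤1′ zero    _      = ≤-refl
  last≤1′ (suc k) last≤1 = subst (_≤ 1) (sym (chainDegree-shift (suc k) (last (suc k)))) last≤1

-- The instance

size-polynomial : ∀ k → suc (suc k * 3) + suc (suc k * 4) + suc (suc k * 4) * (3 + k + (3 + k)) +
                         (k * k * k * k + 12 * k * k * k + 46 * k * k + 67 * k + 42) ≡
                  (3 + k) * ((3 + k) * ((3 + k) * ((3 + k) * 1)))
size-polynomial = solve-∀

module Construction (k : ℕ) where
  K : ℕ
  K = suc k

  L : ℕ
  L = 2 ^ K

  weight : Fin K → ℕ
  weight j = 2 ^ toℕ j

  ends : Fin (suc (K * 4)) → Fin (#V K) × Fin (#V K)
  ends zero    = zero , last K
  ends (suc e) = chainEnds K e

  edgeCost : Fin (suc (K * 4)) → ℕ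
  edgeCost zero    = 2 ^ K
  edgeCost (suc e) = chainCost K weight e

  edgeLength : Fin (suc (K * 4)) → ℕ
  edgeLength zero    = 1
  edgeLength (suc e) = chainLength K L weight e

  weight≤L : ∀ j → weight j ≤ L
  weight≤L j = ^-monoʳ-≤ 2 (FinP.toℕ≤n j)

  chainLength-bounds : ∀ e → 1 ≤ chainLength K L weight e × chainLength K L weight e ≤ L
  chainLength-bounds e with j , r , refl ← FinP.combine-surjective {K} {4} e
    rewrite chainLength-combine K L weight j r = bounds r
    where
    bounds : ∀ r → 1 ≤ gadgetLength L (weight j) r × gadgetLength L (weight j) r ≤ L
    bounds direct  = m^n>0 2 K , ≤-refl
    bounds detour₁ = m^n>0 2 K , ≤-refl
    bounds detour₂ = m^n>0 2 (toℕ j) , weight≤L j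
    bounds bridge  = ≤-refl , m^n>0 2 K

  edgeLength-pos : ∀ e → 1 ≤ edgeLength e
  edgeLength-pos zero    = ≤-refl
  edgeLength-pos (suc e) = proj₁ (chainLength-bounds e)

  I : Instance
  I = record { n = #V K ; m = suc (K * 4) ; ends = ends
             ; c1 = ℤ.+_ ∘ edgeCost ; c2 = edgeLength ; c2-pos = edgeLength-pos }

  open Walks I

  toℕ-last : toℕ (last K) ≡ 3 * K
  toℕ-last = trans (toℕ-entry (Fin.fromℕ K)) (cong (3 *_) (FinP.toℕ-fromℕ K))

  -- The long edge joins positions 0 and 3K, the chain edges positions at distance at most 2.
  long-edge-far : ∀ {u w} → Link I zero u w → ¬ Near 2 (toℕ u) (toℕ w)
  long-edge-far (inj₁ refl) (_ , s≤s (s≤s ()))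
  long-edge-far (inj₂ refl) (s≤s (s≤s ()) , _)

  chain-edge-near : ∀ e {u w} → Link I (suc e) u w → Near 2 (toℕ u) (toℕ w)
  chain-edge-near e = Link-near (suc e) toℕ (ShortChord⇒Near (chainEnds-short K e))

  Link-unique : ∀ e e′ {u w} → Link I e u w → Link I e′ u w → e ≡ e′
  Link-unique zero     zero      _ _  = refl
  Link-unique zero     (suc e′)  l l′ = ⊥-elim (long-edge-far l (chain-edge-near e′ l′))
  Link-unique (suc e)  zero      l l′ = ⊥-elim (long-edge-far l′ (chain-edge-near e l))
  Link-unique (suc e)  (suc e′)  l l′ =
    cong suc (chainEnds-sum-injective K e e′ (trans (Link-sum (suc e) l) (sym (Link-sum (suc e′) l′))))

  simple : Simple I
  simple = no-loop , λ e e′ e≢e′ u w l l′ → e≢e′ (Link-unique e e′ l l′)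
    where
    no-loop : ∀ e → proj₁ (ends e) ≢ proj₂ (ends e)
    no-loop zero    ()
    no-loop (suc e) p≡q = <-irrefl (cong toℕ p≡q) (ShortChord⇒< (chainEnds-short K e))

  degree≤3 : Degree3Bounded I
  degree≤3 v with chainDegrees K | v Fin.≟ zero | v Fin.≟ last K
  ... | _ , first≤2 , _ | yes refl | _        = s≤s first≤2
  ... | _ , _ , last≤1  | no _     | yes refl =
    ≤-trans (+-mono-≤ (incidence≤1 (zero , last K) (last K)) last≤1) (s≤s (s≤s z≤n))
  ... | all≤3 , _ , _   | no v≢0   | no v≢last =
    subst (λ i → i + chainDegree K v ≤ 3) (sym (incidence-other v≢0 v≢last)) (all≤3 v)

  edge-shape : ∀ e → Shape K (toℕ (proj₁ (ends e))) (toℕ (proj₂ (ends e)))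
  edge-shape zero    = inj₂ (refl , toℕ-last)
  edge-shape (suc e) = inj₁ (chainEnds-short K e)

  position≤ : ∀ (v : Fin (#V K)) → toℕ v ≤ 3 * K
  position≤ v = subst (toℕ v ≤_) (*-comm K 3) (FinP.toℕ≤pred[n] v)

  outerplanar : Outerplanar I
  outerplanar = (λ v → v) , (λ eq → eq) , λ e e′ →
    Shape-no-crossing I {K} (edge-shape e) (edge-shape e′) (position≤ _) (position≤ _)

  restrict : EdgeSet (suc (K * 4)) → Fin (K * 4) → Bool
  restrict S e = S (suc e)

  Φ : EdgeSet (suc (K * 4)) → Fin (#V K) → ℕ
  Φ S = potential K L weight (restrict S)

  Φ-walk : ∀ {S u v ℓ} → S zero ≡ false → Walk I S u v ℓ → Φ S v ≤ Φ S u + ℓ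
  Φ-walk {S} avoids-long = Walk-potential (Φ S) step
    where
    step : ∀ e {u w} → S e ≡ true → Link I e u w → Φ S w ≤ Φ S u + edgeLength e
    step zero    s _ with () ← trans (sym s) avoids-long
    step (suc e) s l = proj₂ (Link-near (suc e) (Φ S) (potential-near K L weight (restrict S) e s) l)

  chainSpanner : (Fin K → Bool) → EdgeSet (suc (K * 4))
  chainSpanner δ zero    = false
  chainSpanner δ (suc e) = chainSelect K δ e

  gadgetWalk : ∀ {S} j r → S (suc (Fin.combine j r)) ≡ true →
    Walk I S (proj₁ (gadgetEnds j r)) (proj₂ (gadgetEnds j r)) (gadgetLength L (weight j) r)
  gadgetWalk {S} j r s = subst (Walk I S _ _) (chainLength-combine K L weight j r)
                               (edgeWalk (suc (Fin.combine j r)) s (inj₁ (chainEnds-combine K j r)))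

  crossGadget : ∀ δ j → Walk I (chainSpanner δ) (entry (Fin.inject₁ j)) (entry (suc j))
                                (span L (weight j) (chainSelect K δ (Fin.combine j direct)))
  crossGadget δ j with chainSelect K δ (Fin.combine j direct) in selected
  ... | true  = subst (Walk I _ _ _) (cong (_+ 1) (sym (+-identityʳ L)))
                  (gadgetWalk j direct selected ++ʷ gadgetWalk j bridge (chainSelect-combine K δ j bridge))
  ... | false = (gadgetWalk j detour₁ (chainSelect-combine K δ j detour₁) ++ʷ
                 gadgetWalk j detour₂ (chainSelect-combine K δ j detour₂)) ++ʷ
                 gadgetWalk j bridge (chainSelect-combine K δ j bridge)

  walkToEntry : ∀ δ j → Walk I (chainSpanner δ) zero (entry j) (Φ (chainSpanner δ) (entry j))
  walkToEntry δ = <-weakInduction (λ j → Walk I S zero (entry j) (Φ S (entry j))) nil step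
    where
    S = chainSpanner δ
    step : ∀ i → Walk I S zero (entry (Fin.inject₁ i)) (Φ S (entry (Fin.inject₁ i))) →
                 Walk I S zero (entry (suc i)) (Φ S (entry (suc i)))
    step i p = subst (Walk I S zero (entry (suc i))) (sym (potential-entry-step K L weight (restrict S) i))
                     (p ++ʷ crossGadget δ i)

  chainSpanner-connected : ∀ δ → Connected I (chainSpanner δ)
  chainSpanner-connected δ = connected-from zero reach
    where
    reach : ∀ v → ∃ (Walk I (chainSpanner δ) zero v)
    reach v with vertexKind K v
    ... | at-entry j  = _ , walkToEntry δ j
    ... | at-middle j = _ , walkToEntry δ (Fin.inject₁ j) ++ʷ
                              gadgetWalk j detour₁ (chainSelect-combine K δ j detour₁)
    ... | at-exit j   = _ , walkToEntry δ (Fin.inject₁ j) ++ʷ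
                              (gadgetWalk j detour₁ (chainSelect-combine K δ j detour₁) ++ʷ
                               gadgetWalk j detour₂ (chainSelect-combine K δ j detour₂))

  connected : Connected I (allEdges I)
  connected u v with chainSpanner-connected (λ _ → true) u v
  ... | ℓ , p = ℓ , Walk-⊆ (λ _ _ → refl) p

  D : (Fin K → Bool) → ℕ
  D δ = Φ (chainSpanner δ) (last K)

  D-distance : ∀ δ → IsDist I (chainSpanner δ) zero (last K) (D δ)
  D-distance δ = walkToEntry δ (Fin.fromℕ K) , λ ℓ p → Φ-walk refl p

  long-edge-distance : IsDist I (allEdges I) zero (last K) 1
  long-edge-distance =
    edgeWalk zero refl (inj₁ refl) , λ { ℓ (cons e _ _ _) → ≤-trans (edgeLength-pos e) (m≤m+n _ _) }

  2≤D : ∀ δ → 2 ≤ D δ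
  2≤D δ = ≤-trans (+-monoˡ-≤ 1 (m^n>0 2 K)) (L+1≤potential-last k L weight (chainSelect K δ))

  -- A missing direct edge is bypassed by its detour, of length L + 2^j ≤ 2L ≤ D L.
  edge-detour : ∀ δ e {u w} → Link I e u w →
    ∃ λ ℓ → Walk I (chainSpanner δ) u w ℓ × ℓ ≤ D δ * edgeLength e
  edge-detour δ zero l =
    D δ , Link-walk zero (walkToEntry δ (Fin.fromℕ K)) l , ≤-reflexive (sym (*-identityʳ (D δ)))
  edge-detour δ (suc e) l with chainSelect K δ e in selected
  ... | true  = edgeLength (suc e) , edgeWalk (suc e) selected l ,
                subst (_≤ D δ * edgeLength (suc e)) (*-identityˡ _) (*-monoˡ-≤ _ (≤-trans (s≤s z≤n) (2≤D δ)))
  ... | false with FinP.combine-surjective {K} {4} e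
  ...   | j , r , refl with gadgetSelect-false r (trans (sym (chainSelect-combine K δ j r)) selected)
  ...     | refl = L + weight j , Link-walk (suc (Fin.combine j direct)) detour l , (begin
          L + weight j          ≤⟨ +-monoʳ-≤ L (weight≤L j) ⟩
          L + L                 ≡⟨ cong (L +_) (+-identityʳ L) ⟨
          2 * L                 ≤⟨ *-monoˡ-≤ L (2≤D δ) ⟩
          D δ * L               ≡⟨ cong (D δ *_) (chainLength-combine K L weight j direct) ⟨
          D δ * edgeLength (suc (Fin.combine j direct)) ∎)
    where
    open ≤-Reasoning
    detour : Walk I (chainSpanner δ) (proj₁ (ends (suc (Fin.combine j direct))))
                                     (proj₂ (ends (suc (Fin.combine j direct)))) (L + weight j)
    detour = subst (λ p → Walk I (chainSpanner δ) (proj₁ p) (proj₂ p) (L + weight j))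
                   (sym (chainEnds-combine K j direct))
               (gadgetWalk j detour₁ (chainSelect-combine K δ j detour₁) ++ʷ
                gadgetWalk j detour₂ (chainSelect-combine K δ j detour₂))

  stretch : (Fin K → Bool) → ℚ
  stretch δ = (ℤ.+ D δ) ℚ./ 1

  stretch-f₂ : ∀ δ → IsF₂ I (chainSpanner δ) (stretch δ)
  stretch-f₂ δ = (zero , last K , (λ ()) , D δ , 0 , D-distance δ , long-edge-distance , refl) , bound
    where
    bound : ∀ u v q → u ≢ v → IsRatio I (chainSpanner δ) u v q → q ℚ.≤ stretch δ
    bound u v q _ (dS , k′ , (_ , dS-least) , (pE , _) , refl) with Walk-dilate (D δ) (edge-detour δ) pE
    ... | ℓ , p , ℓ≤ = /-≤-/1 dS (D δ) k′ (≤-trans (dS-least ℓ p) ℓ≤)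

  spannerCost : EdgeSet (suc (K * 4)) → ℕ
  spannerCost S = (if S zero then 2 ^ K else 0) + selectedCost K weight (restrict S)

  f₁≡spannerCost : ∀ S → f₁ I S ≡ ℤ.+ spannerCost S
  f₁≡spannerCost S = sumℤ-if (suc (K * 4)) S edgeCost

  total : ℕ
  total = sumℕ K (λ j → L + weight j + 1)

  spanner : ℕ → EdgeSet (suc (K * 4))
  spanner t = chainSpanner (binary t)

  spanner-cost : ∀ t → t < 2 ^ K → selectedCost K weight (chainSelect K (binary t)) ≡ t
  spanner-cost t t< = trans (selectedCost-select K weight (binary t)) (binary-value K t t<)

  value : ℕ → ValueVec I
  value t = ℤ.+ t , stretch (binary t)

  value-attained : ∀ t → t < 2 ^ K → Attained I (value t)
  value-attained t t< = spanner t , chainSpanner-connected (binary t) ,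
                        trans (f₁≡spannerCost (spanner t)) (cong ℤ.+_ (spanner-cost t t<)) , stretch-f₂ (binary t)

  cost+Φ≡total : ∀ S → S zero ≡ false → spannerCost S + Φ S (last K) ≡ total
  cost+Φ≡total S avoids rewrite avoids = selectedCost+potential K L weight (restrict S)

  t+D≡total : ∀ t → t < 2 ^ K → t + D (binary t) ≡ total
  t+D≡total t t< = trans (cong (_+ D (binary t)) (sym (spanner-cost t t<))) (cost+Φ≡total (spanner t) refl)

  cheap⇒avoids-long : ∀ S t → t < 2 ^ K → spannerCost S ≤ t → S zero ≡ false
  cheap⇒avoids-long S t t< cost≤t with S zero
  ... | false = refl
  ... | true  = ⊥-elim (<⇒≱ t< (≤-trans (m≤m+n (2 ^ K) _) cost≤t))

  -- A spanner at least as good as value t avoids the long edge, so its cost c′ ≤ t and its potential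
  -- Φ′ ≤ d′ ≤ D at the last vertex (d′ its distance from the first vertex) add up to t + D.
  dominating⇒equal : ∀ t S′ q′ → t < 2 ^ K → Connected I S′ → IsF₂ I S′ q′ →
    spannerCost S′ ≤ t → q′ ℚ.≤ stretch (binary t) → spannerCost S′ ≡ t × q′ ≡ stretch (binary t)
  dominating⇒equal t S′ q′ t< connected′ f₂′ cost≤t q′≤ =
    proj₁ tight , ℚP.≤-antisym q′≤ (subst (λ d → (ℤ.+ d) ℚ./ 1 ℚ.≤ q′) d′≡D d′/1≤q′)
    where
    d′ : ℕ
    d′ = proj₁ (shortest (proj₂ (connected′ zero (last K))))
    dist′ : IsDist I S′ zero (last K) d′
    dist′ = proj₂ (shortest (proj₂ (connected′ zero (last K))))
    d′/1≤q′ : (ℤ.+ d′) ℚ./ 1 ℚ.≤ q′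
    d′/1≤q′ = proj₂ f₂′ zero (last K) ((ℤ.+ d′) ℚ./ 1) (λ ()) (d′ , 0 , dist′ , long-edge-distance , refl)
    d′≤D : d′ ≤ D (binary t)
    d′≤D = /1-cancel-≤ d′ (D (binary t)) (ℚP.≤-trans d′/1≤q′ q′≤)
    Φ′≤d′ : Φ S′ (last K) ≤ d′
    Φ′≤d′ = Φ-walk (cheap⇒avoids-long S′ t t< cost≤t) (proj₁ dist′)
    tight : spannerCost S′ ≡ t × Φ S′ (last K) ≡ D (binary t)
    tight = +-tight cost≤t (≤-trans Φ′≤d′ d′≤D)
                    (trans (cost+Φ≡total S′ (cheap⇒avoids-long S′ t t< cost≤t)) (sym (t+D≡total t t<)))
    d′≡D : d′ ≡ D (binary t)
    d′≡D = ≤-antisym d′≤D (subst (_≤ d′) (proj₂ tight) Φ′≤d′)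

  value-nondominated : ∀ t → t < 2 ^ K → NonDominated I (value t)
  value-nondominated t t< = value-attained t t< , not-dominated
    where
    not-dominated : ∀ y′ → Attained I y′ → ¬ _DominatedBy_ I (value t) y′
    not-dominated (a′ , q′) (S′ , connected′ , f₁≡a′ , f₂′) (value≢ , a′≤t , q′≤) =
      value≢ (cong₂ _,_ (sym (trans a′≡cost (cong ℤ.+_ (proj₁ equal)))) (sym (proj₂ equal)))
      where
      a′≡cost : a′ ≡ ℤ.+ spannerCost S′
      a′≡cost = trans (sym f₁≡a′) (f₁≡spannerCost S′)
      cost≤t : spannerCost S′ ≤ t
      cost≤t = ℤP.drop‿+≤+ (subst (ℤ._≤ ℤ.+ t) a′≡cost a′≤t)
      equal : spannerCost S′ ≡ t × q′ ≡ stretch (binary t)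
      equal = dominating⇒equal t S′ q′ t< connected′ f₂′ cost≤t q′≤

  bits≤ : ∀ x → x ≤ 2 ^ K → bits I x ≤ 2 + K
  bits≤ x x≤2^K = s≤s (subst (⌈log₂ suc x ⌉ ≤_) (⌈log₂2^n⌉≡n (suc K)) (⌈log₂⌉-mono-≤ (begin
    suc x          ≤⟨ s≤s x≤2^K ⟩
    1 + 2 ^ K      ≤⟨ +-monoˡ-≤ (2 ^ K) (m^n>0 2 K) ⟩
    2 ^ K + 2 ^ K  ≡⟨ cong (2 ^ K +_) (+-identityʳ (2 ^ K)) ⟨
    2 ^ suc K      ∎)))
    where open ≤-Reasoning

  edgeCost≤ : ∀ e → edgeCost e ≤ 2 ^ K
  edgeCost≤ zero    = ≤-refl
  edgeCost≤ (suc e) with j , r , refl ← FinP.combine-surjective {K} {4} e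
    rewrite chainCost-combine K weight j r = gadgetCost≤ r
    where
    gadgetCost≤ : ∀ r → gadgetCost (weight j) r ≤ 2 ^ K
    gadgetCost≤ direct  = weight≤L j
    gadgetCost≤ detour₁ = z≤n
    gadgetCost≤ detour₂ = z≤n
    gadgetCost≤ bridge  = z≤n

  edgeLength≤ : ∀ e → edgeLength e ≤ 2 ^ K
  edgeLength≤ zero    = m^n>0 2 K
  edgeLength≤ (suc e) = proj₂ (chainLength-bounds e)

  size≤ : size I ≤ (3 + k) ^ 4
  size≤ = begin
    size I
      ≤⟨ +-monoʳ-≤ (#V K + suc (K * 4))
           (sumℕ-≤ (suc (K * 4)) (λ e → +-mono-≤ (bits≤ _ (edgeCost≤ e)) (bits≤ _ (edgeLength≤ e)))) ⟩
    #V K + suc (K * 4) + suc (K * 4) * (2 + K + (2 + K))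
      ≤⟨ m≤m+n _ _ ⟩
    #V K + suc (K * 4) + suc (K * 4) * (2 + K + (2 + K)) +
      (k * k * k * k + 12 * k * k * k + 46 * k * k + 67 * k + 42)
      ≡⟨ size-polynomial k ⟩
    (3 + k) ^ 4 ∎
    where open ≤-Reasoning

theorem1 : (c d : ℕ) → Σ Instance λ I → ValidDeg3Outerplanar I ×
             Σ (List (ValueVec I)) λ ys → Unique ys × All (NonDominated I) ys ×
               (c * size I ^ d + c < length ys)
theorem1 c d = I , (simple , connected , degree≤3 , outerplanar) ,
               values , values-unique , AllP.applyUpTo⁺₁ value (2 ^ K) (λ {t} → value-nondominated t) ,
               subst (c * size I ^ d + c <_) (sym (ListP.length-applyUpTo value (2 ^ K))) polynomial<2^K
  where
  k = proj₁ (polynomial<2^ c (4 * d))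
  open Construction k
  values = applyUpTo value (2 ^ K)
  values-unique : Unique values
  values-unique =
    UniqueP.applyUpTo⁺₁ value (2 ^ K) λ i<j _ same → <-irrefl (ℤP.+-injective (cong proj₁ same)) i<j
  polynomial<2^K : c * size I ^ d + c < 2 ^ K
  polynomial<2^K = begin-strict
    c * size I ^ d + c          ≤⟨ +-monoˡ-≤ c (*-monoʳ-≤ c (^-monoˡ-≤ d size≤)) ⟩
    c * ((3 + k) ^ 4) ^ d + c   ≡⟨ cong (λ x → c * x + c) (^-*-assoc (3 + k) 4 d) ⟩
    c * (3 + k) ^ (4 * d) + c   <⟨ proj₂ (polynomial<2^ c (4 * d)) ⟩
    2 ^ K                       ∎
    where open ≤-Reasoning
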